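{- For every ordered graph $(G,\prec)$ and positive integer $t$, if $\mathrm{Ov}(G,\prec)$ contains $K_{t,t}$ as a subgraph, then $\mathrm{Ov}(G,\prec)$ contains a clean $K_{\lfloor t/2\rfloor,\lfloor t/2\rfloor}$ subgraph.
   Context: An ordered graph $(G,\prec)$ is a finite simple graph with a strict total order $\prec$ on $V(G)$. For an edge $e$, $L(e)$ and $R(e)$ denote its $\prec$-smaller and $\prec$-larger endpoint. Edges $e,f$ cross if $L(e)\prec L(f)\prec R(e)\prec R(f)$ or $L(f)\prec L(e)\prec R(f)\prec R(e)$. The overlap graph $\mathrm{Ov}(G,\prec)$ has vertex set $E(G)$ and an edge between any two crossing edges. A $K_{s,s}$ subgraph (not necessarily induced) of $\mathrm{Ov}(G,\prec)$ with sides $X,Y\subseteq E(G)$ is clean if $X$ is strictly left of $Y$, i.e., $L(e)\prec L(f)$ for every $e\in X$ and $f\in Y$. -}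

module Defs where

open import Data.Nat using (ℕ)
open import Data.Fin using (Fin; _<_)
open import Data.Product using (Σ; _×_; _,_; proj₁; proj₂)
open import Data.Sum using (_⊎_)
open import Relation.Binary.PropositionalEquality using (_≡_)
open import Relation.Nullary using (¬_)
open import Level using (0ℓ)

record Graph (n : ℕ) : Set₁ where
  field
    Adj     : Fin n → Fin n → Set
    sym     : ∀ {u v} → Adj u v → Adj v u
    irrefl  : ∀ {u} → ¬ Adj u u

-- An ordered graph: vertices Fin n, ordered by the usual order on Fin n.
-- (Every finite strict total order is isomorphic to such an order.)

record Edge {n : ℕ} (G : Graph n) : Set where
  constructor edge
  field
    L   : Fin n
    R   : Fin n
    L<R : L < R
    adj : Graph.Adj G L R
open Edge public

SameEdge : ∀ {n} {G : Graph n} → Edge G → Edge G → Set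
SameEdge e f = (L e ≡ L f) × (R e ≡ R f)

Cross : ∀ {n} {G : Graph n} → Edge G → Edge G → Set
Cross e f = (L e < L f × L f < R e × R e < R f)
          ⊎ (L f < L e × L e < R f × R f < R e)

DistinctEdges : ∀ {n} {G : Graph n} (s : ℕ) → (Fin s → Edge G) → Set
DistinctEdges s X = ∀ i j → SameEdge (X i) (X j) → i ≡ j

-- A K_{s,s} subgraph (not necessarily induced) of Ov(G,≺) with sides X, Y:
-- X and Y are s-element sets of edges and every edge of X crosses every
-- edge of Y (disjointness of X and Y follows, since no edge crosses itself).
IsKss : ∀ {n} {G : Graph n} (s : ℕ) → (Fin s → Edge G) → (Fin s → Edge G) → Set
IsKss s X Y = DistinctEdges s X × DistinctEdges s Y × (∀ i j → Cross (X i) (Y j))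

HasKss : ∀ {n} (G : Graph n) (s : ℕ) → Set
HasKss G s = Σ (Fin s → Edge G) λ X → Σ (Fin s → Edge G) λ Y → IsKss s X Y

HasCleanKss : ∀ {n} (G : Graph n) (s : ℕ) → Set
HasCleanKss G s = Σ (Fin s → Edge G) λ X → Σ (Fin s → Edge G) λ Y →
  IsKss s X Y × (∀ i j → L (X i) < L (Y j))

{-# OPTIONS --safe #-}
module Submission where

-- Compare the left endpoints of the two sides of the K_{t,t} against a
-- threshold w that sweeps upwards from 0.  As w grows by one, at most one
-- of the two counts #{e ∈ X : L e < w} and #{f ∈ Y : L f < w} can change,
-- because crossing edges never share their left endpoint.  So the first
-- time one of the counts reaches s = ⌊t/2⌋, the other is still below s,
-- i.e. at least t - s ≥ s edges of the other side have L ≥ w: these s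
-- edges lie strictly right of the s edges counted first, and any s edges
-- of X still cross any s edges of Y.

open import Defs
open import Data.Nat using (ℕ; zero; suc; _/_; _+_; _≤_; _<_; _<?_; _≟_; _⊔_; z≤n; s≤s⁻¹)
open import Data.Nat.Properties
open import Data.Nat.DivMod using (m/n*n≤m)
open import Data.Fin using (Fin; toℕ) renaming (zero to fzero; suc to fsuc)
open import Data.Fin.Properties using (any?; lift-injective) renaming (suc-injective to fsuc-injective)
open import Data.Bool using (if_then_else_)
open import Data.Product using (Σ; ∃; _×_; _,_)
open import Data.Sum using (_⊎_; inj₁; inj₂; swap) renaming (map to ⊎-map)
open import Level using (Level)
open import Function using (_∘_; id)
open import Function.Bundles using (Injection; _↣_; mk↣)
open import Function.Construct.Composition using (_↣-∘_)
open import Relation.Nullary using (¬_; yes; no; does; contradiction)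
open import Relation.Unary using (Pred; Decidable)
open import Relation.Unary.Properties using (∁?)
open import Relation.Binary.PropositionalEquality using (_≡_; _≢_; refl; sym; trans; cong; subst)

open Injection using (to)

module _ {p : Level} where

  count : ∀ {t} {P : Pred (Fin t) p} → Decidable P → ℕ
  count {zero}  P? = 0
  count {suc t} P? = (if does (P? fzero) then suc else id) (count (P? ∘ fsuc))

  count-cong : ∀ {t} {P Q : Pred (Fin t) p} (P? : Decidable P) (Q? : Decidable Q) →
               (∀ i → P i → Q i) → (∀ i → Q i → P i) → count P? ≡ count Q?
  count-cong {zero}  P? Q? P⇒Q Q⇒P = refl
  count-cong {suc t} P? Q? P⇒Q Q⇒P with P? fzero | Q? fzero
  ... | yes _  | yes _  = cong suc (count-cong (P? ∘ fsuc) (Q? ∘ fsuc) (P⇒Q ∘ fsuc) (Q⇒P ∘ fsuc))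
  ... | no _   | no _   = count-cong (P? ∘ fsuc) (Q? ∘ fsuc) (P⇒Q ∘ fsuc) (Q⇒P ∘ fsuc)
  ... | yes P0 | no ¬Q0 = contradiction (P⇒Q fzero P0) ¬Q0
  ... | no ¬P0 | yes Q0 = contradiction (Q⇒P fzero Q0) ¬P0

  count-all : ∀ {t} {P : Pred (Fin t) p} (P? : Decidable P) → (∀ i → P i) → count P? ≡ t
  count-all {zero}  P? all = refl
  count-all {suc t} P? all with P? fzero
  ... | yes _  = cong suc (count-all (P? ∘ fsuc) (all ∘ fsuc))
  ... | no ¬P0 = contradiction (all fzero) ¬P0

  count-none : ∀ {t} {P : Pred (Fin t) p} (P? : Decidable P) → (∀ i → ¬ P i) → count P? ≡ 0
  count-none {zero}  P? none = refl
  count-none {suc t} P? none with P? fzero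
  ... | yes P0 = contradiction P0 (none fzero)
  ... | no _   = count-none (P? ∘ fsuc) (none ∘ fsuc)

  count+count-∁ : ∀ {t} {P : Pred (Fin t) p} (P? : Decidable P) → count P? + count (∁? P?) ≡ t
  count+count-∁ {zero}  P? = refl
  count+count-∁ {suc t} P? with P? fzero
  ... | yes _ = cong suc (count+count-∁ (P? ∘ fsuc))
  ... | no _  = trans (+-suc _ _) (cong suc (count+count-∁ (P? ∘ fsuc)))

  select : ∀ {t s} {P : Pred (Fin t) p} (P? : Decidable P) → s ≤ count P? →
           Σ (Fin s ↣ Fin t) λ σ → ∀ k → P (to σ k)
  select {zero} {zero} P? _ = mk↣ {to = λ ()} (λ { {()} }) , λ ()
  select {suc t} {s} P? s≤c with P? fzero
  select {suc t} {zero}  P? _   | yes _  = mk↣ {to = λ ()} (λ { {()} }) , λ ()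
  select {suc t} {suc s} P? s≤c | yes P0 with select (P? ∘ fsuc) (s≤s⁻¹ s≤c)
  ... | σ , Pσ = mk↣ (lift-injective (to σ) (Injection.injective σ) 1) , λ { fzero → P0 ; (fsuc k) → Pσ k }
  select {suc t} {s} P? s≤c | no _ with select (P? ∘ fsuc) s≤c
  ... | σ , Pσ = mk↣ fsuc-injective ↣-∘ σ , Pσ

upper-bound : ∀ {t} (h : Fin t → ℕ) → ∃ λ n → ∀ i → h i < n
upper-bound {zero}  h = 0 , λ ()
upper-bound {suc t} h with upper-bound (h ∘ fsuc)
... | n , h<n = suc (h fzero) ⊔ n , λ { fzero → m≤m⊔n _ n ; (fsuc i) → <-≤-trans (h<n i) (m≤n⊔m _ n) }

module _ {t : ℕ} where

  below : (Fin t → ℕ) → ℕ → ℕ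
  below h w = count (λ i → h i <? w)

  atLeast : (Fin t → ℕ) → ℕ → ℕ
  atLeast h w = count (∁? (λ i → h i <? w))

  below-zero : ∀ h → below h 0 ≡ 0
  below-zero h = count-none (λ i → h i <? 0) (λ i ())

  below-suc : ∀ h {w} → (∀ i → h i ≢ w) → below h (suc w) ≡ below h w
  below-suc h h≢w = count-cong _ _ (λ i hi<1+w → ≤∧≢⇒< (s≤s⁻¹ hi<1+w) (h≢w i)) (λ i → m<n⇒m<1+n)

  below-upper : ∀ h {n} → (∀ i → h i < n) → below h n ≡ t
  below-upper h h<n = count-all _ h<n

  Separated : ℕ → (Fin t → ℕ) → (Fin t → ℕ) → Set
  Separated s f g = Σ (Fin s ↣ Fin t) λ σ → Σ (Fin s ↣ Fin t) λ τ → ∀ i j → f (to σ i) < g (to τ j)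

  separated-at : ∀ {s f g} w → s ≤ below f w → s ≤ atLeast g w → Separated s f g
  separated-at w s≤f s≤g with select _ s≤f | select _ s≤g
  ... | σ , f<w | τ , g≮w = σ , τ , λ i j → <-≤-trans (f<w i) (≮⇒≥ (g≮w j))

  module Sweep {s} {f g : Fin t → ℕ} (s+s≤t : s + s ≤ t) (f≢g : ∀ i j → f i ≢ g j) where

    Found : Set
    Found = Separated s f g ⊎ Separated s g f

    below<s⇒s≤atLeast : ∀ h {w} → below h w < s → s ≤ atLeast h w
    below<s⇒s≤atLeast h {w} h<s = <⇒≤ (+-cancelˡ-< (below h w) _ _ (begin-strict
      below h w + s                <⟨ +-monoˡ-< s h<s ⟩
      s + s                        ≤⟨ s+s≤t ⟩
      t                            ≡⟨ sym (count+count-∁ _) ⟩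
      below h w + atLeast h w      ∎))
      where open ≤-Reasoning

    advance : ∀ {h k} w → below h w < s → below k w < s ⊎ Separated s k h
    advance {h} {k} w h<s with below k w <? s
    ... | yes k<s = inj₁ k<s
    ... | no k≮s  = inj₂ (separated-at w (≮⇒≥ k≮s) (below<s⇒s≤atLeast h h<s))

    one-side-stays : ∀ w → below f (suc w) ≡ below f w ⊎ below g (suc w) ≡ below g w
    one-side-stays w with any? (λ i → f i ≟ w)
    ... | yes (i , fi≡w) = inj₂ (below-suc g (λ j gj≡w → f≢g i j (trans fi≡w (sym gj≡w))))
    ... | no ∄i          = inj₁ (below-suc f (λ i fi≡w → ∄i (i , fi≡w)))

    sweep : ∀ w → (below f w < s × below g w < s) ⊎ Found
    sweep zero with 0 <? s
    ... | yes 0<s = inj₁ (below<s f , below<s g)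
      where
      below<s : ∀ h → below h 0 < s
      below<s h = subst (_< s) (sym (below-zero h)) 0<s
    ... | no 0≮s  = inj₂ (inj₁ (separated-at {g = g} 0 (subst (s ≤_) (sym (below-zero f)) s≤0) (≤-trans s≤0 z≤n)))
      where s≤0 = ≮⇒≥ 0≮s
    sweep (suc w) with sweep w
    ... | inj₂ found = inj₂ found
    ... | inj₁ (f<s , g<s) with one-side-stays w
    ... | inj₁ f-stays = ⊎-map (f<s′ ,_) inj₂ (advance (suc w) f<s′)
      where f<s′ = subst (_< s) (sym f-stays) f<s
    ... | inj₂ g-stays = ⊎-map (_, g<s′) inj₁ (advance (suc w) g<s′)
      where g<s′ = subst (_< s) (sym g-stays) g<s

    separation : Found
    separation with upper-bound f
    ... | n , f<n with sweep n
    ... | inj₂ found     = found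
    ... | inj₁ (f<s , _) = contradiction (below-upper f f<n) (<⇒≢ (<-≤-trans f<s s≤t))
      where s≤t = ≤-trans (m≤m+n s s) s+s≤t

half+half≤ : ∀ t → t / 2 + t / 2 ≤ t
half+half≤ t = subst (_≤ t) (trans (*-comm (t / 2) 2) (cong (t / 2 +_) (+-identityʳ _))) (m/n*n≤m t 2)

module _ {n} {G : Graph n} where

  cross⇒L≢L : (e f : Edge G) → Cross e f → toℕ (L e) ≢ toℕ (L f)
  cross⇒L≢L e f (inj₁ (Le<Lf , _)) Le≡Lf = <-irrefl Le≡Lf Le<Lf
  cross⇒L≢L e f (inj₂ (Lf<Le , _)) Le≡Lf = <-irrefl (sym Le≡Lf) Lf<Le

  distinct-restrict : ∀ {s t} {X : Fin t → Edge G} → DistinctEdges t X →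
                      (σ : Fin s ↣ Fin t) → DistinctEdges s (X ∘ to σ)
  distinct-restrict distinct σ i j same = Injection.injective σ (distinct (to σ i) (to σ j) same)

  IsKss-restrict : ∀ {s t} {X Y : Fin t → Edge G} → IsKss t X Y →
                   (σ τ : Fin s ↣ Fin t) → IsKss s (X ∘ to σ) (Y ∘ to τ)
  IsKss-restrict {X = X} {Y} (dX , dY , cross) σ τ =
    distinct-restrict {X = X} dX σ , distinct-restrict {X = Y} dY τ , λ i j → cross (to σ i) (to τ j)

  IsKss-swap : ∀ {s} {X Y : Fin s → Edge G} → IsKss s X Y → IsKss s Y X
  IsKss-swap (dX , dY , cross) = dY , dX , λ i j → swap (cross j i)

lemma24 : (n : ℕ) (G : Graph n) (t : ℕ) → 0 Data.Nat.< t → HasKss G t → HasCleanKss G (t / 2)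
lemma24 n G t _ (X , Y , K@(_ , _ , cross)) with Sweep.separation (half+half≤ t) L≢L
  where
  L≢L : ∀ i j → toℕ (L (X i)) ≢ toℕ (L (Y j))
  L≢L i j = cross⇒L≢L (X i) (Y j) (cross i j)
... | inj₁ (σ , τ , X<Y) = X ∘ to σ , Y ∘ to τ , IsKss-restrict {X = X} {Y} K σ τ , X<Y
... | inj₂ (τ , σ , Y<X) = Y ∘ to τ , X ∘ to σ , IsKss-swap {X = X ∘ to σ} {Y ∘ to τ} (IsKss-restrict {X = X} {Y} K σ τ) , Y<X
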